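{- Let $\mathbf{R}^{\mathrm{o}}=\{r_1,\dots,r_n\}$ be a finite set of obligations, $\mathbf{R}=(\emptyset,\mathbf{R}^{\mathrm{o}})$, and $a,x$ Boolean formulas. Then $(\emptyset,\mathbf{R})\mid\sim\bigcirc_{\mathrm{H}}(x/a)$ iff $x\in\bigcap\mathit{outf}(\mathbf{R}^{\mathrm{o}}_{\triangleright},a,\{a\})$, with $out_4^{+}$ as the underlying I/O operation.
   Context: Obligations are $\bigcirc(x/a)$ with $a,x$ Boolean (body $b=a$, head $h=x$). Override: relative to a fixed set $\Gamma$ of alethic formulas ($\Box$ over Boolean formulas), $r_j\triangleright r_i$ iff (i) $\{h(r_i),h(r_j)\}\cup\Gamma\models_{\mathrm{S5}}\bot$, (ii) $b(r_j)\models_{\mathrm{PL}}b(r_i)$ and $b(r_i)\not\models_{\mathrm{PL}}b(r_j)$, (iii) $h(r_i)\wedge b(r_j)\not\models_{\mathrm{PL}}\bot$. $V(w)=\{r_i\in\mathbf{R}^{\mathrm{o}}: w\models b(r_i)\wedge\neg h(r_i)$ and $w\not\models b(r_j)$ for all $r_j\triangleright r_i\}$. An $\mathbf{R}$-ordered model is $(W,\succeq_N,\succeq_I,v)$ with $W$ nonempty, valuation $v$, $\succeq_N=W\times W$, and $w_1\succeq_I w_2$ iff $V(w_1)\subseteq V(w_2)$; it is replete if every PL-consistent Boolean formula is true at some world. Standing assumption for this result: all models considered are replete. $\max_{\succeq_I}(X)=\{w\in X:\forall u\in X(u\succeq_I w\Rightarrow w\succeq_I u)\}$; $\Vert a\Vert$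 the truth set. Hanssonian obligation: $M,w\models\bigcirc_{\mathrm{H}}(x/a)$ iff $\max_{\succeq_I}(\Vert a\Vert)\subseteq\Vert x\Vert$. Entailment: $(\Gamma,\mathbf{R})\mid\sim A$ iff for every (replete) $\mathbf{R}$-ordered model $M$ and world $w$ at which all of $\Gamma$ holds, $M,w\models A$. Translation: for $r_i=\bigcirc(x/a)$, $D(r_i)=\{r_j: r_j\triangleright r_i\}$; $r_i^{\triangleright}=(a\wedge\bigwedge_{r_j\in D(r_i)}\neg b(r_j),\,x)$ if $D(r_i)\neq\emptyset$, else $(a,x)$; $\mathbf{R}^{\mathrm{o}}_{\triangleright}=\{r_1^{\triangleright},\dots,r_n^{\triangleright}\}$. I/O logic: for a set $N$ of pairs $(c,y)$ of Boolean formulas, $\mathrm{m}(N)=\{c\rightarrow y:(c,y)\in N\}$, $out_4^{+}(N,a)=\{y:\{a\}\cup\mathrm{m}(N)\models_{\mathrm{PL}}y\}$; $\mathit{maxf}(N,a,C)$ is the set of $\subseteq$-maximal $H\subseteq N$ with $out_4^{+}(H,a)\cup C$ PL-consistent; $\mathit{outf}(N,a,C)=\{out_4^{+}(H,a): H\in\mathit{maxf}(N,a,C)\}$. -}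

module Defs where

open import Data.Nat using (ℕ)
open import Data.Bool using (Bool; true; false; _∧_; _∨_; not; if_then_else_)
open import Data.Fin using (Fin)
open import Data.List using (List; []; _∷_; foldr; allFin)
open import Data.List.Relation.Unary.All using (All)
open import Data.Product using (Σ; _×_; _,_)
open import Data.Sum using (_⊎_)
open import Relation.Nullary using (¬_)
open import Relation.Binary.PropositionalEquality using (_≡_)

data Form : Set where
  atom : ℕ → Form
  ⊤f   : Form
  ⊥f   : Form
  ¬f_  : Form → Form
  _∧f_ : Form → Form → Form
  _∨f_ : Form → Form → Form
  _⇒f_ : Form → Form → Form

Valuation : Set
Valuation = ℕ → Bool

⟦_⟧ : Form → Valuation → Bool
⟦ atom p ⟧ v = v p
⟦ ⊤f ⟧ v = true
⟦ ⊥f ⟧ v = false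
⟦ ¬f φ ⟧ v = not (⟦ φ ⟧ v)
⟦ φ ∧f ψ ⟧ v = ⟦ φ ⟧ v ∧ ⟦ ψ ⟧ v
⟦ φ ∨f ψ ⟧ v = ⟦ φ ⟧ v ∨ ⟦ ψ ⟧ v
⟦ φ ⇒f ψ ⟧ v = not (⟦ φ ⟧ v) ∨ ⟦ ψ ⟧ v

_⊨_ : Valuation → Form → Set
v ⊨ φ = ⟦ φ ⟧ v ≡ true

_⊨PL_ : List Form → Form → Set
Ps ⊨PL φ = ∀ v → All (v ⊨_) Ps → v ⊨ φ

_⊨PLs_ : (Form → Set) → Form → Set
S ⊨PLs φ = ∀ v → (∀ ψ → S ψ → v ⊨ ψ) → v ⊨ φ

ConsistentSet : (Form → Set) → Set
ConsistentSet S = Σ Valuation λ v → ∀ ψ → S ψ → v ⊨ ψ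

-- Obligations ○(x/a) represented as pairs (body a , head x);
-- a finite set R^o = {r_1..r_n} is indexed by Fin n.

Obligation : Set
Obligation = Form × Form

body : Obligation → Form
body (a , x) = a

head : Obligation → Form
head (a , x) = x

Obls : ℕ → Set
Obls n = Fin n → Obligation

-- Override r_j ▷ r_i relative to Γ = ∅.
-- Condition (i): {h(r_i), h(r_j)} ⊨_S5 ⊥ with Γ = ∅.  For Boolean formulas
-- S5-unsatisfiability coincides with PL-unsatisfiability (S5 is conservative
-- over PL), so it is stated as PL consequence of ⊥.
Overrides : ∀ {n} → Obls n → Fin n → Fin n → Set
Overrides R j i =
  ((head (R i) ∷ head (R j) ∷ []) ⊨PL ⊥f)
  × ((body (R j) ∷ []) ⊨PL body (R i))
  × ¬ ((body (R i) ∷ []) ⊨PL body (R j))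
  × ¬ (((head (R i) ∧f body (R j)) ∷ []) ⊨PL ⊥f)

InV : ∀ {n} → Obls n → Valuation → Fin n → Set
InV R v i =
  (v ⊨ (body (R i) ∧f (¬f head (R i))))
  × (∀ j → Overrides R j i → ¬ (v ⊨ body (R j)))

-- R-ordered models (W, ≽_N = W×W, ≽_I, v); ≽_N plays no role below.

≽I : ∀ {n} {W : Set} → Obls n → (W → Valuation) → W → W → Set
≽I R val w₁ w₂ = ∀ i → InV R (val w₁) i → InV R (val w₂) i

InMaxI : ∀ {n} {W : Set} → Obls n → (W → Valuation) → Form → W → Set
InMaxI R val a w =
  (val w ⊨ a) × (∀ u → val u ⊨ a → ≽I R val u w → ≽I R val w u)

Replete : {W : Set} → (W → Valuation) → Set
Replete {W} val = ∀ φ → (Σ Valuation λ v → v ⊨ φ) → Σ W λ w → val w ⊨ φ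

SatOH : ∀ {n} {W : Set} → Obls n → (W → Valuation) → W → Form → Form → Set
SatOH R val w x a = ∀ u → InMaxI R val a u → val u ⊨ x

-- (∅, (∅, R^o)) |~ ○_H(x/a): in every replete R-ordered model, at every
-- world (Γ = ∅ holds everywhere).  Nonemptiness of W is witnessed by w.
EntailsOH : ∀ {n} → Obls n → Form → Form → Set₁
EntailsOH R x a =
  (W : Set) (val : W → Valuation) → Replete val → (w : W) → SatOH R val w x a

-- Translation R^o_▷, parameterised by a decider d for the override relation
-- (d j i ≡ true  iff  r_j ▷ r_i).

DecidesOverride : ∀ {n} → Obls n → (Fin n → Fin n → Bool) → Set
DecidesOverride R d =
  ∀ j i → (d j i ≡ true → Overrides R j i) × (Overrides R j i → d j i ≡ true)

negBodies : ∀ {n} → Obls n → (Fin n → Fin n → Bool) → Fin n → List Form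
negBodies {n} R d i =
  foldr (λ j acc → if d j i then (¬f body (R j)) ∷ acc else acc) [] (allFin n)

conj : Form → List Form → Form
conj φ [] = φ
conj φ (ψ ∷ ψs) = φ ∧f conj ψ ψs

transBody : Form → List Form → Form
transBody a [] = a
transBody a (ψ ∷ ψs) = a ∧f conj ψ ψs

translate : ∀ {n} → Obls n → (Fin n → Fin n → Bool) → Obls n
translate R d i = (transBody (body (R i)) (negBodies R d i) , head (R i))

-- I/O logic with out_4^+ ; subsets H ⊆ N given by characteristic functions

SubsetOf : ℕ → Set
SubsetOf n = Fin n → Bool

_⊆H_ : ∀ {n} → SubsetOf n → SubsetOf n → Set
H ⊆H H' = ∀ i → H i ≡ true → H' i ≡ true

Prems : ∀ {n} → Obls n → SubsetOf n → Form → Form → Set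
Prems N H a ψ = (ψ ≡ a) ⊎ Σ _ λ i → (H i ≡ true) × (ψ ≡ (body (N i) ⇒f head (N i)))

Out4 : ∀ {n} → Obls n → SubsetOf n → Form → Form → Set
Out4 N H a y = Prems N H a ⊨PLs y

InMaxf : ∀ {n} → Obls n → Form → (Form → Set) → SubsetOf n → Set
InMaxf N a C H =
  ConsistentSet (λ ψ → Out4 N H a ψ ⊎ C ψ)
  × (∀ H' → H ⊆H H' → ConsistentSet (λ ψ → Out4 N H' a ψ ⊎ C ψ) → H' ⊆H H)

-- x ∈ ⋂ outf(N, a, C)   (the empty intersection is the set of all formulas)
InBigCapOutf : ∀ {n} → Obls n → Form → (Form → Set) → Form → Set
InBigCapOutf N a C x = ∀ H → InMaxf N a C H → Out4 N H a x

{-# OPTIONS --safe #-}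
-- Under the translation, w violates r_i^▷ exactly when r_i ∈ V(w): the extra
-- conjuncts ¬ b(r_j) of the translated body say that no overriding r_j is
-- triggered.  Hence w₁ ≽_I w₂ iff every translated norm satisfied at w₂ is
-- satisfied at w₁, and the ≽_I-best a-worlds of a replete model are the a-worlds
-- whose set of satisfied translated norms is a maxfamily; repleteness, applied to
-- a ∧ ⋀ m(H), is what turns a consistent H into a world.  Conversely, a model of
-- {a} ∪ m(H) for a maxfamily H satisfies exactly the norms of H, so in the model
-- of all valuations it is ≽_I-best.
module Submission where

open import Defs
open import Data.Nat using (ℕ; zero; suc)
open import Data.Bool using (Bool; true; false; _∧_; _∨_; not; if_then_else_)
open import Data.Fin using (Fin; zero; suc)
open import Data.Fin.Properties using (∀-cons-⇔)
open import Data.List using (List; []; _∷_; foldr; allFin)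
open import Data.List.Relation.Unary.All using (All; []; _∷_)
import Data.List.Relation.Unary.All as All
open import Data.List.Relation.Unary.All.Properties using (tabulate⁺; tabulate⁻)
open import Data.Product using (Σ; _×_; _,_; proj₁; proj₂; map₂)
open import Data.Product.Function.NonDependent.Propositional using (_×-⇔_)
open import Data.Sum using (_⊎_; inj₁; inj₂)
open import Function using (id; _∘_; _$_; const)
open import Function.Bundles using (_⇔_; mk⇔; Equivalence)
open import Function.Construct.Composition using (_⇔-∘_)
open import Function.Construct.Symmetry using (⇔-sym)
open import Relation.Nullary using (¬_; contradiction)
open import Relation.Binary.PropositionalEquality using (_≡_; refl; sym; trans)

open Equivalence using (to; from)

∧≡true⇔ : ∀ {x y} → x ∧ y ≡ true ⇔ (x ≡ true × y ≡ true)
∧≡true⇔ {true}  = mk⇔ (refl ,_) proj₂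
∧≡true⇔ {false} = mk⇔ (λ ()) (λ { (() , _) })

not≡true⇔ : ∀ {x} → not x ≡ true ⇔ (¬ x ≡ true)
not≡true⇔ {true}  = mk⇔ (λ ()) (λ x≢true → contradiction refl x≢true)
not≡true⇔ {false} = mk⇔ (λ _ ()) (λ _ → refl)

∧-not≡true⇔not-∨≡false : ∀ {x y} → x ∧ not y ≡ true ⇔ not x ∨ y ≡ false
∧-not≡true⇔not-∨≡false {true}  {true}  = mk⇔ (λ ()) (λ ())
∧-not≡true⇔not-∨≡false {true}  {false} = mk⇔ (λ _ → refl) (λ _ → refl)
∧-not≡true⇔not-∨≡false {false}         = mk⇔ (λ ()) (λ ())

≡false-mono⇔≡true-antitone : ∀ {x y} → (x ≡ false → y ≡ false) ⇔ (y ≡ true → x ≡ true)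
≡false-mono⇔≡true-antitone {true}          = mk⇔ (λ _ _ → refl) (λ _ ())
≡false-mono⇔≡true-antitone {false} {true}  =
  mk⇔ (λ f → contradiction (f refl) λ ()) (λ g → contradiction (g refl) λ ())
≡false-mono⇔≡true-antitone {false} {false} = mk⇔ (λ _ ()) (λ _ _ → refl)

All-foldr-if⇔ : ∀ {A B : Set} (P : B → Set) (g : A → Bool) (f : A → B) (xs : List A) →
  All P (foldr (λ x acc → if g x then f x ∷ acc else acc) [] xs)
    ⇔ All (λ x → g x ≡ true → P (f x)) xs
All-foldr-if⇔ P g f [] = mk⇔ (const []) (const [])
All-foldr-if⇔ P g f (x ∷ xs) with g x in gx | All-foldr-if⇔ P g f xs
... | true  | ih = mk⇔ (λ { (p ∷ ps) → const p ∷ ih .to ps })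
                       (λ { (p ∷ ps) → p gx ∷ ih .from ps })
... | false | ih = mk⇔ (λ ps → (λ gx≡true → contradiction (trans (sym gx≡true) gx) λ ())
                                ∷ ih .to ps)
                       (λ { (_ ∷ ps) → ih .from ps })

⊆H-refl : ∀ {n} {H : SubsetOf n} → H ⊆H H
⊆H-refl _ = id

⊆H-trans : ∀ {n} {H₁ H₂ H₃ : SubsetOf n} → H₁ ⊆H H₂ → H₂ ⊆H H₃ → H₁ ⊆H H₃
⊆H-trans H₁⊆H₂ H₂⊆H₃ i = H₂⊆H₃ i ∘ H₁⊆H₂ i

module _ {v : Valuation} where

  ⊨∧f⇔ : ∀ φ ψ → v ⊨ (φ ∧f ψ) ⇔ (v ⊨ φ × v ⊨ ψ)
  ⊨∧f⇔ _ _ = ∧≡true⇔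

  ⊨¬f⇔ : ∀ φ → v ⊨ (¬f φ) ⇔ (¬ v ⊨ φ)
  ⊨¬f⇔ _ = not≡true⇔

  ⊨if-⊤f⇔ : ∀ b φ → v ⊨ (if b then φ else ⊤f) ⇔ (b ≡ true → v ⊨ φ)
  ⊨if-⊤f⇔ true  φ = mk⇔ const (_$ refl)
  ⊨if-⊤f⇔ false φ = mk⇔ (λ _ ()) (λ _ → refl)

  ⊨conj⇔ : ∀ φ ψs → v ⊨ conj φ ψs ⇔ All (v ⊨_) (φ ∷ ψs)
  ⊨conj⇔ φ []       = mk⇔ (_∷ []) All.head
  ⊨conj⇔ φ (ψ ∷ ψs) =
    mk⇔ (λ vφ∧ψs → let (vφ , vψs) = ⊨∧f⇔ φ (conj ψ ψs) .to vφ∧ψs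
                   in vφ ∷ ⊨conj⇔ ψ ψs .to vψs)
        (λ { (vφ ∷ vψs) → ⊨∧f⇔ φ (conj ψ ψs) .from (vφ , ⊨conj⇔ ψ ψs .from vψs) })

  ⊨transBody⇔ : ∀ a ψs → v ⊨ transBody a ψs ⇔ All (v ⊨_) (a ∷ ψs)
  ⊨transBody⇔ a []       = ⊨conj⇔ a []
  ⊨transBody⇔ a (ψ ∷ ψs) = ⊨conj⇔ a (ψ ∷ ψs)

m : Obligation → Form
m r = body r ⇒f head r

satisfied : ∀ {n} → Obls n → Valuation → SubsetOf n
satisfied N v i = ⟦ m (N i) ⟧ v

Violated : Valuation → Obligation → Set
Violated v r = v ⊨ (body r ∧f (¬f head r))

Violated⇔unsatisfied : ∀ {n} (N : Obls n) {v} i → Violated v (N i) ⇔ satisfied N v i ≡ false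
Violated⇔unsatisfied N {v} i =
  ∧-not≡true⇔not-∨≡false {⟦ body (N i) ⟧ v} {⟦ head (N i) ⟧ v}

IsModel : ∀ {n} → Obls n → SubsetOf n → Form → Valuation → Set
IsModel N H a v = v ⊨ a × H ⊆H satisfied N v

⋀m : ∀ {n} → Obls n → SubsetOf n → Form
⋀m {zero}  N H = ⊤f
⋀m {suc n} N H =
  (if H zero then m (N zero) else ⊤f) ∧f ⋀m (N ∘ suc) (H ∘ suc)

⊨⋀m⇔ : ∀ {n} (N : Obls n) H {v} → v ⊨ ⋀m N H ⇔ H ⊆H satisfied N v
⊨⋀m⇔ {zero}  N H = mk⇔ (λ _ ()) (λ _ → refl)
⊨⋀m⇔ {suc n} N H =
  ∀-cons-⇔ ⇔-∘ ((⊨if-⊤f⇔ (H zero) (m (N zero)) ×-⇔ ⊨⋀m⇔ (N ∘ suc) (H ∘ suc))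
                 ⇔-∘ ⊨∧f⇔ (if H zero then m (N zero) else ⊤f) (⋀m (N ∘ suc) (H ∘ suc)))

module _ {n} (N : Obls n) (a : Form) where

  ⊨Prems⇔IsModel : ∀ {H v} → (∀ ψ → Prems N H a ψ → v ⊨ ψ) ⇔ IsModel N H a v
  ⊨Prems⇔IsModel = mk⇔
    (λ ⊨prems → ⊨prems a (inj₁ refl) , λ i Hi → ⊨prems _ (inj₂ (i , Hi , refl)))
    (λ { (va , _) ψ (inj₁ refl) → va ; (_ , H⊆) ψ (inj₂ (i , Hi , refl)) → H⊆ i Hi })

  consistent⇔model : ∀ {H} →
    ConsistentSet (λ ψ → Out4 N H a ψ ⊎ ψ ≡ a) ⇔ Σ Valuation (IsModel N H a)
  consistent⇔model = mk⇔
    (λ (v , ⊨out) → v , ⊨Prems⇔IsModel .to λ ψ p → ⊨out ψ (inj₁ λ _ ⊨prems → ⊨prems ψ p))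
    (λ (v , model) → v , λ { ψ (inj₁ out) → out v (⊨Prems⇔IsModel .from model)
                           ; ψ (inj₂ refl) → proj₁ model })

  replete-model : ∀ {H} {W : Set} {val : W → Valuation} → Replete val →
    Σ Valuation (IsModel N H a) → Σ W (IsModel N H a ∘ val)
  replete-model {H} rep (v , va , H⊆) =
    let (w , w⊨) = rep (a ∧f ⋀m N H) (v , ⊨∧f⇔ a (⋀m N H) .from (va , ⊨⋀m⇔ N H .from H⊆))
    in w , map₂ (⊨⋀m⇔ N H .to) (⊨∧f⇔ a (⋀m N H) .to w⊨)

  InMaxf-satisfied : ∀ {H v} → InMaxf N a (_≡ a) H → IsModel N H a v →
    InMaxf N a (_≡ a) (satisfied N v)
  InMaxf-satisfied {v = v} (_ , maximal) (va , H⊆) =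
    consistent⇔model .from (v , va , ⊆H-refl) ,
    λ H′ v⊆H′ consistent → ⊆H-trans (maximal H′ (⊆H-trans H⊆ v⊆H′) consistent) H⊆

module _ {n} (R : Obls n) {d : Fin n → Fin n → Bool} (dec : DecidesOverride R d) where

  private
    N : Obls n
    N = translate R d

  unblocked⇔ : ∀ {v} i →
    (∀ j → Overrides R j i → ¬ v ⊨ body (R j)) ⇔ All (v ⊨_) (negBodies R d i)
  unblocked⇔ {v} i =
    ⇔-sym (All-foldr-if⇔ (v ⊨_) (λ j → d j i) (λ j → ¬f body (R j)) (allFin n))
    ⇔-∘ (mk⇔ tabulate⁺ tabulate⁻
    ⇔-∘ mk⇔ (λ unblocked j dji → ⊨¬f⇔ (body (R j)) .from (unblocked j (proj₁ (dec j i) dji)))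
            (λ unblocked j ov → ⊨¬f⇔ (body (R j)) .to (unblocked j (proj₂ (dec j i) ov))))

  InV⇔Violated : ∀ {v} i → InV R v i ⇔ Violated v (N i)
  InV⇔Violated {v} i = mk⇔ violated inV
    where
    bᵢ = body (R i)
    ¬hᵢ = ¬f head (R i)

    violated : InV R v i → Violated v (N i)
    violated (b∧¬h , unblocked) =
      let (vb , v¬h) = ⊨∧f⇔ bᵢ ¬hᵢ .to b∧¬h
      in ⊨∧f⇔ (body (N i)) ¬hᵢ .from
           (⊨transBody⇔ bᵢ (negBodies R d i) .from (vb ∷ unblocked⇔ i .to unblocked) , v¬h)

    inV : Violated v (N i) → InV R v i
    inV viol with ⊨∧f⇔ (body (N i)) ¬hᵢ .to viol
    ... | vbody , v¬h with ⊨transBody⇔ bᵢ (negBodies R d i) .to vbody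
    ... | vb ∷ vnegs = ⊨∧f⇔ bᵢ ¬hᵢ .from (vb , v¬h) , unblocked⇔ i .from vnegs

  InV⇔unsatisfied : ∀ {v} i → InV R v i ⇔ satisfied N v i ≡ false
  InV⇔unsatisfied i = Violated⇔unsatisfied N i ⇔-∘ InV⇔Violated i

  ≽I⇔⊇ : ∀ {W : Set} (val : W → Valuation) w₁ w₂ →
    ≽I R val w₁ w₂ ⇔ satisfied N (val w₂) ⊆H satisfied N (val w₁)
  ≽I⇔⊇ val w₁ w₂ = mk⇔
    (λ V₁⊆V₂ i → ≡false-mono⇔≡true-antitone .to
                   (InV⇔unsatisfied i .to ∘ V₁⊆V₂ i ∘ InV⇔unsatisfied i .from))
    (λ S₂⊆S₁ i → InV⇔unsatisfied i .from
                   ∘ ≡false-mono⇔≡true-antitone .from (S₂⊆S₁ i)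
                   ∘ InV⇔unsatisfied i .to)

  InMaxI⇔InMaxf : ∀ {W : Set} {val : W → Valuation} {a w} → Replete val →
    InMaxI R val a w ⇔ (val w ⊨ a × InMaxf N a (_≡ a) (satisfied N (val w)))
  InMaxI⇔InMaxf {val = val} {a} {w} rep =
    mk⇔ (λ (va , best) → va , toMaxf va best) (map₂ toMaxI)
    where
    toMaxf : val w ⊨ a → (∀ u → val u ⊨ a → ≽I R val u w → ≽I R val w u) →
      InMaxf N a (_≡ a) (satisfied N (val w))
    toMaxf va best =
      consistent⇔model N a .from (val w , va , ⊆H-refl) ,
      λ H′ w⊆H′ consistent →
        let (u , ua , H′⊆u) = replete-model N a rep (consistent⇔model N a .to consistent)
            u≽w = ≽I⇔⊇ val u w .from (⊆H-trans w⊆H′ H′⊆u)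
        in ⊆H-trans H′⊆u (≽I⇔⊇ val w u .to (best u ua u≽w))

    toMaxI : InMaxf N a (_≡ a) (satisfied N (val w)) →
      ∀ u → val u ⊨ a → ≽I R val u w → ≽I R val w u
    toMaxI (_ , maximal) u ua u≽w =
      ≽I⇔⊇ val w u .from
        (maximal _ (≽I⇔⊇ val u w .to u≽w) (consistent⇔model N a .from (val u , ua , ⊆H-refl)))

theorem3 : (n : ℕ) (R : Obls n) (d : Fin n → Fin n → Bool) → DecidesOverride R d →
    (a x : Form) →
    EntailsOH R x a ⇔ InBigCapOutf (translate R d) a (λ ψ → ψ ≡ a) x
theorem3 n R d dec a x = mk⇔ sound complete
  where
  N = translate R d

  sound : EntailsOH R x a → InBigCapOutf N a (_≡ a) x
  sound entails H maxf v ⊨prems =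
    let model = ⊨Prems⇔IsModel N a .to ⊨prems
        best  = InMaxI⇔InMaxf R dec id-replete .from
                  (proj₁ model , InMaxf-satisfied N a maxf model)
    in entails Valuation id id-replete v v best
    where
    id-replete : Replete id
    id-replete _ sat = sat

  complete : InBigCapOutf N a (_≡ a) x → EntailsOH R x a
  complete cap W val rep _ u best =
    let (ua , maxf) = InMaxI⇔InMaxf R dec rep .to best
    in cap (satisfied N (val u)) maxf (val u) (⊨Prems⇔IsModel N a .from (ua , ⊆H-refl))
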